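{- Let $d>2$ be an integer and let $f:\mathbb{F}_2^d\to\mathbb{F}_2$ be a linear bipermutive local rule $f(x_1,\ldots,x_d)=a_1x_1\oplus\cdots\oplus a_dx_d$ (so $a_1=a_d=1$), with associated polynomial $p_f(X) = a_1 + a_2X + \cdots + a_dX^{d-1}\in\mathbb{F}_2[X]$. Let $F:\mathbb{F}_2^{2(d-1)}\to\mathbb{F}_2^{d-1}$ be the no-boundary cellular automaton with local rule $f$. If $p_f(X)$ is irreducible over $\mathbb{F}_2$, then $F$ is self-orthogonal.
   Context: For a local rule $f:\mathbb{F}_2^d\to\mathbb{F}_2$, the no-boundary cellular automaton (NBCA) $F:\mathbb{F}_2^{2(d-1)}\to\mathbb{F}_2^{d-1}$ is defined by $F(x_1,\ldots,x_{2(d-1)}) = (f(x_1,\ldots,x_d), f(x_2,\ldots,x_{d+1}),\ldots, f(x_{d-1},\ldots,x_{2(d-1)}))$. The rule $f$ is bipermutive if it is a permutation in the first variable when the others are fixed, and in the last variable when the others are fixed. Let $N = 2^{d-1}$, fix a bijection $\phi:\mathbb{F}_2^{d-1}\to\{1,\ldots,N\}$ with inverse $\psi$. The Cayley table of $F$ is the $N\times N$ matrix $C_F$ with $C_F(i,j) = \phi(F(\psi(i)\|\psi(j)))$ ($\|$ is concatenation); for bipermutive $f$ it is a Latin square. Two Latin squares $L_1,L_2$ of order $N$ are orthogonal if the pairs $(L_1(i,j),L_2(i,j))$ are pairwise distinct over all $(i,j)$. $F$ is self-orthogonal if $C_F$ is orthogonal to its transpose $C_F^\top$. -}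

module Defs where

open import Data.Bool using (Bool; true; false; _∧_; _xor_)
open import Data.Nat using (ℕ; zero; suc; _+_; _^_; _<_; _≤_; s≤s)
open import Data.Nat.Properties using (+-mono-<-≤)
open import Data.Fin using (Fin; toℕ; fromℕ<)
open import Data.Fin.Properties using (toℕ<n)
open import Data.Vec using (Vec; lookup; tabulate; zipWith; foldr′; _++_; head; last; toList)
open import Data.List using (List; []; _∷_)
open import Data.Product using (_×_; _,_)
open import Data.Sum using (_⊎_)
open import Relation.Binary.PropositionalEquality using (_≡_)
open import Relation.Nullary using (¬_)
open import Function.Bundles using (_↔_; Inverse)

-- 𝔽₂ is modelled by Bool, with addition _xor_ and multiplication _∧_.

-- Local rules and no-boundary cellular automata.
-- The diameter is d = suc m (so m = d - 1).

linearRule : ∀ {d} → Vec Bool d → Vec Bool d → Bool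
linearRule a x = foldr′ _xor_ false (zipWith _∧_ a x)

private
  window-idx : ∀ {m} → Fin m → Fin (suc m) → Fin (m + m)
  window-idx {m} i j =
    fromℕ< (+-mono-<-≤ (toℕ<n i) (lemma (toℕ<n j)))
    where
    lemma : ∀ {k n} → k < suc n → k ≤ n
    lemma (s≤s p) = p

-- NBCA F : 𝔽₂^{2(d-1)} → 𝔽₂^{d-1},
-- F(x)_i = f(x_i, …, x_{i+d-1})  (0-based indices)
NBCA : ∀ {m} → (Vec Bool (suc m) → Bool) → Vec Bool (m + m) → Vec Bool m
NBCA {m} f x = tabulate λ i → f (tabulate λ j → lookup x (window-idx i j))

Square : ℕ → Set
Square N = Fin N → Fin N → Fin N

cayley : ∀ {m} → (Vec Bool (m + m) → Vec Bool m) →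
         (Vec Bool m ↔ Fin (2 ^ m)) → Square (2 ^ m)
cayley F φ i j = Inverse.to φ (F (Inverse.from φ i ++ Inverse.from φ j))

transpose : ∀ {N} → Square N → Square N
transpose L i j = L j i

Orthogonal : ∀ {N} → Square N → Square N → Set
Orthogonal L₁ L₂ = ∀ i j k l →
  (L₁ i j , L₂ i j) ≡ (L₁ k l , L₂ k l) → (i ≡ k × j ≡ l)

SelfOrthogonal : ∀ {m} → (Vec Bool (m + m) → Vec Bool m) →
                 (Vec Bool m ↔ Fin (2 ^ m)) → Set
SelfOrthogonal F φ = Orthogonal (cayley F φ) (transpose (cayley F φ))

-- Polynomials over 𝔽₂ as coefficient lists (constant term first).

Poly : Set
Poly = List Bool

coeff : Poly → ℕ → Bool
coeff []      _       = false
coeff (c ∷ p) zero    = c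
coeff (c ∷ p) (suc k) = coeff p k

-- equality of polynomials (ignores trailing zero coefficients)
_≈ₚ_ : Poly → Poly → Set
p ≈ₚ q = ∀ k → coeff p k ≡ coeff q k

addP : Poly → Poly → Poly
addP []      q       = q
addP (c ∷ p) []      = c ∷ p
addP (c ∷ p) (e ∷ q) = (c xor e) ∷ addP p q

scaleP : Bool → Poly → Poly
scaleP c []      = []
scaleP c (e ∷ q) = (c ∧ e) ∷ scaleP c q

mulP : Poly → Poly → Poly
mulP []      q = []
mulP (c ∷ p) q = addP (scaleP c q) (false ∷ mulP p q)

zeroP oneP : Poly
zeroP = []
oneP  = true ∷ []

-- irreducible in 𝔽₂[X]: nonzero, not a unit (the only unit is 1),
-- and every factorisation has a unit factor.
Irreducible : Poly → Set
Irreducible p = ¬ (p ≈ₚ zeroP) × ¬ (p ≈ₚ oneP) ×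
  (∀ g h → p ≈ₚ mulP g h → (g ≈ₚ oneP) ⊎ (h ≈ₚ oneP))

assocPoly : ∀ {d} → Vec Bool d → Poly
assocPoly a = toList a

module Submission where

-- Write m = d - 1. The Cayley table of F is orthogonal to its transpose as soon as
-- (x , y) ↦ (F (x ‖ y) , F (y ‖ x)) is injective; as F is additive over 𝔽₂, this means that
-- F (z ‖ w) = F (w ‖ z) = 0 forces z = w = 0. Adding the two equations gives F (v ‖ v) = 0 for
-- v = z ⊕ w, so it suffices that F (v ‖ v) = 0 forces v = 0: then z = w, and F (z ‖ z) = 0.
--
-- If F (v ‖ v) = 0, the m-periodic extension u of v satisfies p_f(σ) u = 0 for the shift σ,
-- and trivially (1 + Xᵐ)(σ) u = 0. The leading terms of p_f and 1 + Xᵐ cancel, so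
-- q = p_f + 1 + Xᵐ annihilates u and has degree < m; q ≠ 0 because 1 + Xᵐ is divisible by
-- 1 + X and hence reducible for m ≥ 2. Euclid's algorithm run inside the annihilator of u
-- yields a common divisor of p_f and q that annihilates u and has degree < m. Since p_f is
-- irreducible that divisor is 1, so u = 0.

open import Defs
open import Algebra.Bundles using (CommutativeRing)
open import Data.Bool using (Bool; true; false; _∧_; _xor_)
open import Data.Bool.Properties
  using (xor-same; xor-comm; xor-assoc; xor-identityʳ; ∧-zeroʳ; ∧-distribˡ-xor; ∧-distribʳ-xor;
         xor-∧-commutativeRing)
open import Algebra.Properties.CommutativeSemigroup (CommutativeRing.+-commutativeSemigroup xor-∧-commutativeRing)
  using () renaming (interchange to xor-interchange)
open import Data.Empty using (⊥-elim)
open import Data.Fin using (Fin; toℕ; splitAt; _↑ˡ_; _↑ʳ_)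
import Data.Fin as Fin
open import Data.Fin.Properties
  using (toℕ-fromℕ<; toℕ-injective; toℕ<n; toℕ-↑ˡ; toℕ-↑ʳ; splitAt⁻¹-↑ˡ; splitAt⁻¹-↑ʳ)
open import Data.List using ([]; _∷_; replicate)
open import Data.Nat using (ℕ; zero; suc; _+_; _^_; _≤_; _<_; z≤n; s≤s; s≤s⁻¹; NonZero; _%_)
open import Data.Nat.DivMod using (_mod_; m%n<n; [m+n]%n≡m%n; m<n⇒m%n≡m; %-distribˡ-+; m%n%n≡m%n)
open import Data.Nat.Induction using (<-wellFounded)
open import Data.Nat.Properties
  using (≤-refl; ≤-trans; ≤-<-trans; ≤-total; m≤m+n; m≤n⇒m≤1+n; m≤n⇒m<n∨m≡n; m≤n⇒∃[o]m+o≡n;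
         +-comm; +-assoc; +-identityʳ; +-monoˡ-<; +-monoʳ-<; +-mono-<-≤)
open import Data.Product using (∃-syntax; _×_; _,_; map)
open import Data.Product.Properties using (,-injectiveˡ; ,-injectiveʳ)
open import Data.Sum using (_⊎_; inj₁; inj₂; [_,_]′)
open import Data.Vec using (Vec; []; _∷_; head; last; toList; lookup; tabulate; zipWith; _++_)
  renaming (replicate to replicateᵥ)
open import Data.Vec.Properties
  using (lookup∘tabulate; tabulate-cong; lookup-zipWith; zipWith-++; zipWith-comm; lookup-replicate;
         lookup-++ˡ; lookup-++ʳ; ∷-injective)
open import Data.Vec.Relation.Binary.Pointwise.Extensional using (ext; Pointwise-≡⇒≡)
open import Function using (_∘_)
open import Function.Bundles using (_↔_; Injection)
open import Function.Construct.Symmetry using (↔-sym)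
open import Function.Properties.Inverse using (↔⇒↣)
open import Induction.WellFounded using (Acc; acc)
open import Relation.Binary.PropositionalEquality
  using (_≡_; refl; sym; trans; cong; cong₂; subst; module ≡-Reasoning)
open import Relation.Nullary using (¬_)

open ≡-Reasoning

xor≡false⇒≡ : ∀ {x y} → x xor y ≡ false → x ≡ y
xor≡false⇒≡ {false} {false} _ = refl
xor≡false⇒≡ {true}  {true}  _ = refl

infixr 25 X^_*_

X^_*_ : ℕ → Poly → Poly
X^ zero  * g = g
X^ suc k * g = false ∷ X^ k * g

infix 25 1+X^_

1+X^_ : ℕ → Poly
1+X^ m = addP oneP (X^ m * oneP)

coeff-addP : ∀ g h k → coeff (addP g h) k ≡ coeff g k xor coeff h k
coeff-addP []      h       k       = refl
coeff-addP (c ∷ g) []      k       = sym (xor-identityʳ _)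
coeff-addP (c ∷ g) (e ∷ h) zero    = refl
coeff-addP (c ∷ g) (e ∷ h) (suc k) = coeff-addP g h k

coeff-scaleP : ∀ c g k → coeff (scaleP c g) k ≡ c ∧ coeff g k
coeff-scaleP c []      k       = sym (∧-zeroʳ c)
coeff-scaleP c (e ∷ g) zero    = refl
coeff-scaleP c (e ∷ g) (suc k) = coeff-scaleP c g k

coeff-mulP-∷ : ∀ c g h k → coeff (mulP (c ∷ g) h) k ≡ (c ∧ coeff h k) xor coeff (false ∷ mulP g h) k
coeff-mulP-∷ c g h k = trans (coeff-addP (scaleP c h) _ k) (cong (_xor _) (coeff-scaleP c h k))

∷-cong : ∀ c {g h} → g ≈ₚ h → (c ∷ g) ≈ₚ (c ∷ h)
∷-cong c g≈h zero    = refl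
∷-cong c g≈h (suc k) = g≈h k

false∷-≈zero : ∀ {g} → g ≈ₚ zeroP → (false ∷ g) ≈ₚ zeroP
false∷-≈zero g≈0 zero    = refl
false∷-≈zero g≈0 (suc k) = g≈0 k

≈ₚ⇒addP≈zero : ∀ {g h} → g ≈ₚ h → addP g h ≈ₚ zeroP
≈ₚ⇒addP≈zero {g} {h} g≈h k =
  trans (coeff-addP g h k) (trans (cong (_xor coeff h k) (g≈h k)) (xor-same (coeff h k)))

addP≈zero⇒≈ₚ : ∀ {g h} → addP g h ≈ₚ zeroP → g ≈ₚ h
addP≈zero⇒≈ₚ {g} {h} g+h≈0 k = xor≡false⇒≡ (trans (sym (coeff-addP g h k)) (g+h≈0 k))

addP-cancelʳ : ∀ g h → addP (addP g h) h ≈ₚ g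
addP-cancelʳ g h k = begin
  coeff (addP (addP g h) h) k              ≡⟨ coeff-addP (addP g h) h k ⟩
  coeff (addP g h) k xor coeff h k         ≡⟨ cong (_xor coeff h k) (coeff-addP g h k) ⟩
  (coeff g k xor coeff h k) xor coeff h k  ≡⟨ xor-assoc (coeff g k) _ _ ⟩
  coeff g k xor (coeff h k xor coeff h k)  ≡⟨ cong (coeff g k xor_) (xor-same (coeff h k)) ⟩
  coeff g k xor false                      ≡⟨ xor-identityʳ (coeff g k) ⟩
  coeff g k                                ∎

X^*-cong : ∀ k {g h} → g ≈ₚ h → X^ k * g ≈ₚ X^ k * h
X^*-cong zero    g≈h       = g≈h
X^*-cong (suc k) g≈h zero    = refl
X^*-cong (suc k) g≈h (suc j) = X^*-cong k g≈h j

mulP-zeroˡ : ∀ g h → g ≈ₚ zeroP → mulP g h ≈ₚ zeroP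
mulP-zeroˡ []      h g≈0 k = refl
mulP-zeroˡ (c ∷ g) h g≈0 k with refl ← g≈0 0 =
  trans (coeff-mulP-∷ false g h k) (false∷-≈zero (mulP-zeroˡ g h (g≈0 ∘ suc)) k)

mulP-congˡ : ∀ g g′ h → g ≈ₚ g′ → mulP g h ≈ₚ mulP g′ h
mulP-congˡ []      g′       h g≈g′ k = sym (mulP-zeroˡ g′ h (sym ∘ g≈g′) k)
mulP-congˡ (c ∷ g) []       h g≈g′ k = mulP-zeroˡ (c ∷ g) h g≈g′ k
mulP-congˡ (c ∷ g) (c′ ∷ g′) h g≈g′ k with refl ← g≈g′ 0 = begin
  coeff (mulP (c ∷ g) h) k
    ≡⟨ coeff-mulP-∷ c g h k ⟩
  (c ∧ coeff h k) xor coeff (false ∷ mulP g h) k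
    ≡⟨ cong ((c ∧ coeff h k) xor_) (∷-cong false (mulP-congˡ g g′ h (g≈g′ ∘ suc)) k) ⟩
  (c ∧ coeff h k) xor coeff (false ∷ mulP g′ h) k
    ≡⟨ coeff-mulP-∷ c g′ h k ⟨
  coeff (mulP (c ∷ g′) h) k
    ∎

mulP-identityˡ : ∀ h → mulP oneP h ≈ₚ h
mulP-identityˡ h k = begin
  coeff (mulP oneP h) k                    ≡⟨ coeff-mulP-∷ true [] h k ⟩
  coeff h k xor coeff (false ∷ []) k       ≡⟨ cong (coeff h k xor_) (false∷-≈zero (λ _ → refl) k) ⟩
  coeff h k xor false                      ≡⟨ xor-identityʳ (coeff h k) ⟩
  coeff h k                                ∎

X^*-mulP : ∀ k g h → X^ k * mulP g h ≈ₚ mulP (X^ k * g) h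
X^*-mulP zero    g h j = refl
X^*-mulP (suc k) g h j =
  trans (∷-cong false (X^*-mulP k g h) j) (sym (coeff-mulP-∷ false (X^ k * g) h j))

mulP-distribʳ : ∀ g g′ h → mulP (addP g g′) h ≈ₚ addP (mulP g h) (mulP g′ h)
mulP-distribʳ []      g′       h k = refl
mulP-distribʳ (c ∷ g) []       h k = sym (trans (coeff-addP (mulP (c ∷ g) h) [] k) (xor-identityʳ _))
mulP-distribʳ (c ∷ g) (c′ ∷ g′) h k = begin
  coeff (mulP ((c xor c′) ∷ addP g g′) h) k
    ≡⟨ coeff-mulP-∷ (c xor c′) (addP g g′) h k ⟩
  ((c xor c′) ∧ hₖ) xor coeff (false ∷ mulP (addP g g′) h) k
    ≡⟨ cong (((c xor c′) ∧ hₖ) xor_) (∷-cong false (mulP-distribʳ g g′ h) k) ⟩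
  ((c xor c′) ∧ hₖ) xor coeff (addP (false ∷ mulP g h) (false ∷ mulP g′ h)) k
    ≡⟨ cong₂ _xor_ (∧-distribʳ-xor hₖ c c′) (coeff-addP (false ∷ mulP g h) (false ∷ mulP g′ h) k) ⟩
  ((c ∧ hₖ) xor (c′ ∧ hₖ)) xor (coeff (false ∷ mulP g h) k xor coeff (false ∷ mulP g′ h) k)
    ≡⟨ xor-interchange (c ∧ hₖ) (c′ ∧ hₖ) (coeff (false ∷ mulP g h) k) (coeff (false ∷ mulP g′ h) k) ⟩
  ((c ∧ hₖ) xor coeff (false ∷ mulP g h) k) xor ((c′ ∧ hₖ) xor coeff (false ∷ mulP g′ h) k)
    ≡⟨ cong₂ _xor_ (coeff-mulP-∷ c g h k) (coeff-mulP-∷ c′ g′ h k) ⟨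
  coeff (mulP (c ∷ g) h) k xor coeff (mulP (c′ ∷ g′) h) k
    ≡⟨ coeff-addP (mulP (c ∷ g) h) (mulP (c′ ∷ g′) h) k ⟨
  coeff (addP (mulP (c ∷ g) h) (mulP (c′ ∷ g′) h)) k
    ∎
  where hₖ = coeff h k

infix 4 _∣ₚ_

_∣ₚ_ : Poly → Poly → Set
h ∣ₚ g = ∃[ α ] g ≈ₚ mulP α h

∣ₚ-refl : ∀ h → h ∣ₚ h
∣ₚ-refl h = oneP , sym ∘ mulP-identityˡ h

∣ₚ-reduce : ∀ {h} a k b → h ∣ₚ addP a (X^ k * b) → h ∣ₚ b → h ∣ₚ a
∣ₚ-reduce {h} a k b (α , a′≈αh) (β , b≈βh) = addP α (X^ k * β) , λ j → begin
  coeff a j                                           ≡⟨ addP-cancelʳ a (X^ k * b) j ⟨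
  coeff (addP a′ (X^ k * b)) j                        ≡⟨ coeff-addP a′ (X^ k * b) j ⟩
  coeff a′ j xor coeff (X^ k * b) j                   ≡⟨ cong₂ _xor_ (a′≈αh j) (X^*-cong k {b} b≈βh j) ⟩
  coeff (mulP α h) j xor coeff (X^ k * mulP β h) j    ≡⟨ cong (coeff (mulP α h) j xor_) (X^*-mulP k β h j) ⟩
  coeff (mulP α h) j xor coeff (mulP (X^ k * β) h) j  ≡⟨ coeff-addP (mulP α h) (mulP (X^ k * β) h) j ⟨
  coeff (addP (mulP α h) (mulP (X^ k * β) h)) j       ≡⟨ mulP-distribʳ α (X^ k * β) h j ⟨
  coeff (mulP (addP α (X^ k * β)) h) j                ∎
  where a′ = addP a (X^ k * b)

DegreeBelow : Poly → ℕ → Set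
DegreeBelow g n = ∀ j → n ≤ j → coeff g j ≡ false

record Degree (g : Poly) (d : ℕ) : Set where
  constructor degree
  field
    leading : coeff g d ≡ true
    below   : DegreeBelow g (suc d)

oneP-degree : Degree oneP 0
oneP-degree = degree refl λ { (suc j) _ → refl }

Degree-∷ : ∀ {g d} c → Degree g d → Degree (c ∷ g) (suc d)
Degree-∷ c (degree g-d g<) = degree g-d λ { (suc j) (s≤s d<j) → g< j d<j }

Degree-X^* : ∀ k {g d} → Degree g d → Degree (X^ k * g) (k + d)
Degree-X^* zero    g-deg = g-deg
Degree-X^* (suc k) g-deg = Degree-∷ false (Degree-X^* k g-deg)

Degree-X^ : ∀ k → Degree (X^ k * oneP) k
Degree-X^ zero    = oneP-degree
Degree-X^ (suc k) = Degree-∷ false (Degree-X^ k)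

Degree-1+X^ : ∀ n → Degree (1+X^ suc n) (suc n)
Degree-1+X^ n = Degree-∷ true (Degree-X^ n)

Degree-toList : ∀ {m} (a : Vec Bool (suc m)) → last a ≡ true → Degree (toList a) m
Degree-toList {zero}  (c ∷ []) refl      = oneP-degree
Degree-toList {suc m} (c ∷ a)  last≡true = Degree-∷ c (Degree-toList a last≡true)

addP-cancels-leading : ∀ {g h d} → Degree g d → Degree h d → DegreeBelow (addP g h) d
addP-cancels-leading {g} {h} (degree g-d g<) (degree h-d h<) j d≤j with m≤n⇒m<n∨m≡n d≤j
... | inj₁ d<j  = trans (coeff-addP g h j) (cong₂ _xor_ (g< j d<j) (h< j d<j))
... | inj₂ refl = trans (coeff-addP g h j) (cong₂ _xor_ g-d h-d)

zero⊎degree< : ∀ g n → DegreeBelow g n → g ≈ₚ zeroP ⊎ ∃[ d ] d < n × Degree g d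
zero⊎degree< g zero    g<0   = inj₁ (λ k → g<0 k z≤n)
zero⊎degree< g (suc n) g<1+n with coeff g n in gₙ≡
... | true  = inj₂ (n , ≤-refl , degree gₙ≡ g<1+n)
... | false = [ inj₁ , (λ (d , d<n , g-d) → inj₂ (d , m≤n⇒m≤1+n d<n , g-d)) ]′ (zero⊎degree< g n g<n)
  where
  g<n : DegreeBelow g n
  g<n j n≤j with m≤n⇒m<n∨m≡n n≤j
  ... | inj₁ n<j  = g<1+n j n<j
  ... | inj₂ refl = gₙ≡

-- Polynomials acting on sequences

-- eval g w = Σⱼ gⱼ wⱼ, so Annihilates g u says g(σ) u = 0 for the left shift σ, and cell i
-- of a linear NBCA is eval p_f applied to the window starting at i.

eval : Poly → (ℕ → Bool) → Bool
eval []      w = false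
eval (c ∷ g) w = (c ∧ w 0) xor eval g (w ∘ suc)

record Annihilates (g : Poly) (u : ℕ → Bool) : Set where
  constructor annihilates
  field eval≡false : ∀ i → eval g (λ j → u (i + j)) ≡ false
open Annihilates

eval-cong : ∀ g {w w′} → (∀ j → w j ≡ w′ j) → eval g w ≡ eval g w′
eval-cong []      w≗w′ = refl
eval-cong (c ∷ g) w≗w′ = cong₂ (λ x y → (c ∧ x) xor y) (w≗w′ 0) (eval-cong g (w≗w′ ∘ suc))

eval-addP : ∀ g h w → eval (addP g h) w ≡ eval g w xor eval h w
eval-addP []      h       w = refl
eval-addP (c ∷ g) []      w = sym (xor-identityʳ _)
eval-addP (c ∷ g) (e ∷ h) w = begin
  ((c xor e) ∧ w 0) xor eval (addP g h) (w ∘ suc)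
    ≡⟨ cong₂ _xor_ (∧-distribʳ-xor (w 0) c e) (eval-addP g h (w ∘ suc)) ⟩
  ((c ∧ w 0) xor (e ∧ w 0)) xor (eval g (w ∘ suc) xor eval h (w ∘ suc))
    ≡⟨ xor-interchange (c ∧ w 0) (e ∧ w 0) (eval g (w ∘ suc)) (eval h (w ∘ suc)) ⟩
  ((c ∧ w 0) xor eval g (w ∘ suc)) xor ((e ∧ w 0) xor eval h (w ∘ suc))
    ∎

eval-X^* : ∀ k g w → eval (X^ k * g) w ≡ eval g (λ j → w (k + j))
eval-X^* zero    g w = refl
eval-X^* (suc k) g w = eval-X^* k g (w ∘ suc)

eval-X^ : ∀ k w → eval (X^ k * oneP) w ≡ w k
eval-X^ zero    w = xor-identityʳ (w 0)
eval-X^ (suc k) w = eval-X^ k (w ∘ suc)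

eval-zero : ∀ g w → g ≈ₚ zeroP → eval g w ≡ false
eval-zero []      w g≈0 = refl
eval-zero (c ∷ g) w g≈0 with refl ← g≈0 0 = eval-zero g (w ∘ suc) (g≈0 ∘ suc)

eval-≈ : ∀ g h w → g ≈ₚ h → eval g w ≡ eval h w
eval-≈ g h w g≈h =
  xor≡false⇒≡ (trans (sym (eval-addP g h w)) (eval-zero (addP g h) w (≈ₚ⇒addP≈zero {g} {h} g≈h)))

Annihilates-≈ : ∀ {g h u} → g ≈ₚ h → Annihilates g u → Annihilates h u
Annihilates-≈ {g} {h} g≈h g-ann = annihilates λ i → trans (sym (eval-≈ g h _ g≈h)) (eval≡false g-ann i)

Annihilates-addP-X^* : ∀ {a b u} k → Annihilates a u → Annihilates b u → Annihilates (addP a (X^ k * b)) u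
Annihilates-addP-X^* {a} {b} {u} k a-ann b-ann = annihilates λ i → let w = λ j → u (i + j) in begin
  eval (addP a (X^ k * b)) w        ≡⟨ eval-addP a (X^ k * b) w ⟩
  eval a w xor eval (X^ k * b) w    ≡⟨ cong (eval a w xor_) (eval-X^* k b w) ⟩
  eval a w xor eval b (λ j → w (k + j))
    ≡⟨ cong₂ _xor_ (eval≡false a-ann i)
                   (trans (eval-cong b (λ j → cong u (sym (+-assoc i k j)))) (eval≡false b-ann (i + k))) ⟩
  false                             ∎

Annihilates-1+X^ : ∀ {m u} → (∀ i → u (i + m) ≡ u i) → Annihilates (1+X^ m) u
Annihilates-1+X^ {m} {u} u-periodic = annihilates λ i → let w = λ j → u (i + j) in begin
  eval (1+X^ m) w                        ≡⟨ eval-addP oneP (X^ m * oneP) w ⟩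
  eval oneP w xor eval (X^ m * oneP) w   ≡⟨ cong₂ _xor_ (eval-X^ 0 w) (eval-X^ m w) ⟩
  u (i + 0) xor u (i + m)                ≡⟨ cong₂ _xor_ (cong u (+-identityʳ i)) (u-periodic i) ⟩
  u i xor u i                            ≡⟨ xor-same (u i) ⟩
  false                                  ∎

annihilated-by-oneP : ∀ {u} → Annihilates oneP u → ∀ i → u i ≡ false
annihilated-by-oneP {u} 1-ann i =
  subst (λ t → u t ≡ false) (+-identityʳ i) (trans (sym (eval-X^ 0 (λ j → u (i + j)))) (eval≡false 1-ann i))

-- Euclid's algorithm

module _ (I : Poly → Set) (I-closed : ∀ {a b} k → I a → I b → I (addP a (X^ k * b))) where

  record CommonDivisor (a b : Poly) (da db : ℕ) : Set where
    field
      divisor        : Poly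
      deg            : ℕ
      divisor-degree : Degree divisor deg
      deg≤da         : deg ≤ da
      deg≤db         : deg ≤ db
      divisor∈I      : I divisor
      divisor∣a      : divisor ∣ₚ a
      divisor∣b      : divisor ∣ₚ b

  private
    swap : ∀ {a b da db} → CommonDivisor a b da db → CommonDivisor b a db da
    swap cd = record
      { divisor = divisor ; deg = deg ; divisor-degree = divisor-degree
      ; deg≤da = deg≤db ; deg≤db = deg≤da ; divisor∈I = divisor∈I
      ; divisor∣a = divisor∣b ; divisor∣b = divisor∣a }
      where open CommonDivisor cd

    reduce : ∀ {a b db} k → Degree a (db + k) → Degree b db → I a → I b →
             (∀ {a′ da′} → da′ < db + k → Degree a′ da′ → I a′ → CommonDivisor a′ b da′ db) →
             CommonDivisor a b (db + k) db
    reduce {a} {b} {db} k a-deg b-deg a∈I b∈I recurse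
      with zero⊎degree< (addP a (X^ k * b)) (db + k)
             (addP-cancels-leading a-deg (subst (Degree (X^ k * b)) (+-comm k db) (Degree-X^* k b-deg)))
    ... | inj₁ a′≈0 = record
      { divisor = b ; deg = db ; divisor-degree = b-deg
      ; deg≤da = m≤m+n db k ; deg≤db = ≤-refl ; divisor∈I = b∈I
      ; divisor∣a = ∣ₚ-reduce a k b (zeroP , a′≈0) (∣ₚ-refl b) ; divisor∣b = ∣ₚ-refl b }
    ... | inj₂ (_ , da′<da , a′-deg) = record
      { divisor = divisor ; deg = deg ; divisor-degree = divisor-degree
      ; deg≤da = ≤-trans deg≤db (m≤m+n db k) ; deg≤db = deg≤db ; divisor∈I = divisor∈I
      ; divisor∣a = ∣ₚ-reduce a k b divisor∣a divisor∣b ; divisor∣b = divisor∣b }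
      where open CommonDivisor (recurse da′<da a′-deg (I-closed k a∈I b∈I))

  common-divisor : ∀ {a b da db} → Acc _<_ (da + db) → Degree a da → Degree b db → I a → I b →
                   CommonDivisor a b da db
  common-divisor {da = da} {db} (acc smaller) a-deg b-deg a∈I b∈I with ≤-total db da
  ... | inj₁ db≤da with k , refl ← m≤n⇒∃[o]m+o≡n db≤da =
    reduce k a-deg b-deg a∈I b∈I λ da′<da a′-deg a′∈I →
      common-divisor (smaller (+-monoˡ-< db da′<da)) a′-deg b-deg a′∈I b∈I
  ... | inj₂ da≤db with k , refl ← m≤n⇒∃[o]m+o≡n da≤db =
    swap (reduce k b-deg a-deg b∈I a∈I λ db′<db b′-deg b′∈I →
      swap (common-divisor (smaller (+-monoʳ-< da db′<db)) a-deg b′-deg a∈I b′∈I))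

divisor-of-irreducible : ∀ {p h dp dh} → Irreducible p → Degree p dp → h ∣ₚ p → Degree h dh → dh < dp →
                         h ≈ₚ oneP
divisor-of-irreducible {p} {h} {dp} (_ , _ , irreducible) (degree p-dp _) (α , p≈αh) (degree _ h<) dh<dp
  with irreducible α h p≈αh
... | inj₂ h≈1 = h≈1
... | inj₁ α≈1 with () ← begin
  true                 ≡⟨ p-dp ⟨
  coeff p dp           ≡⟨ p≈αh dp ⟩
  coeff (mulP α h) dp  ≡⟨ mulP-congˡ α oneP h α≈1 dp ⟩
  coeff (mulP oneP h) dp ≡⟨ mulP-identityˡ h dp ⟩
  coeff h dp           ≡⟨ h< dp dh<dp ⟩
  false                ∎

annihilated-by-irreducible : ∀ {p q dp dq u} → Irreducible p → Degree p dp → Degree q dq → dq < dp →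
                             Annihilates p u → Annihilates q u → ∀ i → u i ≡ false
annihilated-by-irreducible {u = u} p-irr p-deg q-deg dq<dp p-ann q-ann =
  annihilated-by-oneP (Annihilates-≈ divisor≈1 divisor∈I)
  where
  open CommonDivisor (common-divisor (λ g → Annihilates g u) Annihilates-addP-X^*
                                     (<-wellFounded _) p-deg q-deg p-ann q-ann)
  divisor≈1 : divisor ≈ₚ oneP
  divisor≈1 = divisor-of-irreducible p-irr p-deg divisor∣a divisor-degree (≤-<-trans deg≤db dq<dp)

replicate-xor-suc : ∀ n k → coeff (replicate n true) k xor coeff (replicate (suc n) true) k ≡ coeff (X^ n * oneP) k
replicate-xor-suc zero    zero    = refl
replicate-xor-suc zero    (suc k) = refl
replicate-xor-suc (suc n) zero    = refl
replicate-xor-suc (suc n) (suc k) = replicate-xor-suc n k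

1+X^-factorisation : ∀ n → 1+X^ suc n ≈ₚ mulP (true ∷ true ∷ []) (replicate (suc n) true)
1+X^-factorisation n zero    = refl
1+X^-factorisation n (suc k) = sym (begin
  coeff (mulP (true ∷ oneP) ones) (suc k)          ≡⟨ coeff-mulP-∷ true oneP ones (suc k) ⟩
  coeff (replicate n true) k xor coeff (mulP oneP ones) k
    ≡⟨ cong (coeff (replicate n true) k xor_) (mulP-identityˡ ones k) ⟩
  coeff (replicate n true) k xor coeff ones k      ≡⟨ replicate-xor-suc n k ⟩
  coeff (X^ n * oneP) k                            ∎)
  where ones = replicate (suc n) true

irreducible-≉1+X^ : ∀ {p} n → Irreducible p → ¬ (p ≈ₚ 1+X^ suc (suc n))
irreducible-≉1+X^ {p} n (_ , _ , irreducible) p≈1+Xᵐ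
  with irreducible (true ∷ true ∷ []) (replicate (suc (suc n)) true)
         (λ k → trans (p≈1+Xᵐ k) (1+X^-factorisation (suc n) k))
... | inj₁ 1+X≈1  with () ← 1+X≈1 1
... | inj₂ ones≈1 with () ← ones≈1 1

periodic-annihilated-by-irreducible : ∀ {n p u} → let m = suc (suc n) in
  Irreducible p → Degree p m → (∀ i → u (i + m) ≡ u i) → Annihilates p u → ∀ i → u i ≡ false
periodic-annihilated-by-irreducible {n} {p} {u} p-irr p-deg u-periodic p-ann =
  [ (λ q≈0 → ⊥-elim (irreducible-≉1+X^ {p} n p-irr (addP≈zero⇒≈ₚ {p} {1+X^ suc (suc n)} q≈0)))
  , (λ (_ , dq<m , q-deg) → annihilated-by-irreducible p-irr p-deg q-deg dq<m p-ann q-ann)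
  ]′ (zero⊎degree< q (suc (suc n)) (addP-cancels-leading p-deg (Degree-1+X^ (suc n))))
  where
  q = addP p (1+X^ suc (suc n))
  q-ann : Annihilates q u
  q-ann = Annihilates-addP-X^* 0 p-ann (Annihilates-1+X^ u-periodic)

-- Periodic extensions

module _ {A : Set} {m : ℕ} .{{_ : NonZero m}} (v : Vec A m) where

  cycle : ℕ → A
  cycle k = lookup v (k mod m)

  cycle-cong-% : ∀ {k l} → k % m ≡ l % m → cycle k ≡ cycle l
  cycle-cong-% k≡l = cong (lookup v) (toℕ-injective (trans (toℕ-fromℕ< _) (trans k≡l (sym (toℕ-fromℕ< _)))))

  cycle-toℕ : ∀ i → cycle (toℕ i) ≡ lookup v i
  cycle-toℕ i = cong (lookup v) (toℕ-injective (trans (toℕ-fromℕ< _) (m<n⇒m%n≡m (toℕ<n i))))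

  cycle-periodic : ∀ k → cycle (k + m) ≡ cycle k
  cycle-periodic k = cycle-cong-% ([m+n]%n≡m%n k m)

  cycle-+ : ∀ i j → cycle (i + j) ≡ cycle (i % m + j)
  cycle-+ i j = cycle-cong-% (begin
    (i + j) % m              ≡⟨ %-distribˡ-+ i j m ⟩
    (i % m + j % m) % m      ≡⟨ cong (λ t → (t + j % m) % m) (m%n%n≡m%n i m) ⟨
    (i % m % m + j % m) % m  ≡⟨ %-distribˡ-+ (i % m) j m ⟨
    (i % m + j) % m          ∎)

  lookup-++-cycle : ∀ k → lookup (v ++ v) k ≡ cycle (toℕ k)
  lookup-++-cycle k with splitAt m k in k≡
  ... | inj₁ i with refl ← splitAt⁻¹-↑ˡ k≡ = begin
    lookup (v ++ v) (i ↑ˡ m)  ≡⟨ lookup-++ˡ v v i ⟩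
    lookup v i                ≡⟨ cycle-toℕ i ⟨
    cycle (toℕ i)             ≡⟨ cong cycle (toℕ-↑ˡ i m) ⟨
    cycle (toℕ (i ↑ˡ m))      ∎
  ... | inj₂ i with refl ← splitAt⁻¹-↑ʳ k≡ = begin
    lookup (v ++ v) (m ↑ʳ i)  ≡⟨ lookup-++ʳ v v i ⟩
    lookup v i                ≡⟨ cycle-toℕ i ⟨
    cycle (toℕ i)             ≡⟨ cycle-periodic (toℕ i) ⟨
    cycle (toℕ i + m)         ≡⟨ cong cycle (trans (+-comm (toℕ i) m) (sym (toℕ-↑ʳ m i))) ⟩
    cycle (toℕ (m ↑ʳ i))      ∎

infixl 6 _⊕_

_⊕_ : ∀ {n} → Vec Bool n → Vec Bool n → Vec Bool n
_⊕_ = zipWith _xor_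

⊕-self : ∀ {n} (x : Vec Bool n) → x ⊕ x ≡ replicateᵥ n false
⊕-self []      = refl
⊕-self (x ∷ xs) = cong₂ _∷_ (xor-same x) (⊕-self xs)

⊕≡0⇒≡ : ∀ {n} {x y : Vec Bool n} → x ⊕ y ≡ replicateᵥ n false → x ≡ y
⊕≡0⇒≡ {x = []}     {[]}     _  = refl
⊕≡0⇒≡ {x = x ∷ xs} {y ∷ ys} eq with x⊕y≡0 , xs⊕ys≡0 ← ∷-injective eq =
  cong₂ _∷_ (xor≡false⇒≡ x⊕y≡0) (⊕≡0⇒≡ xs⊕ys≡0)

zipWith-tabulate : ∀ {A B C : Set} {n} (f : A → B → C) (g : Fin n → A) (h : Fin n → B) →
                   zipWith f (tabulate g) (tabulate h) ≡ tabulate (λ i → f (g i) (h i))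
zipWith-tabulate {n = zero}  f g h = refl
zipWith-tabulate {n = suc n} f g h =
  cong (f (g Fin.zero) (h Fin.zero) ∷_) (zipWith-tabulate f (g ∘ Fin.suc) (h ∘ Fin.suc))

linearRule-⊕ : ∀ {n} (a x y : Vec Bool n) → linearRule a (x ⊕ y) ≡ linearRule a x xor linearRule a y
linearRule-⊕ []      []      []      = refl
linearRule-⊕ (c ∷ a) (x ∷ xs) (y ∷ ys) =
  trans (cong₂ _xor_ (∧-distribˡ-xor c x y) (linearRule-⊕ a xs ys))
        (xor-interchange (c ∧ x) (c ∧ y) (linearRule a xs) (linearRule a ys))

-- Definitionally equal to the private window index of NBCA, as fromℕ< ignores its proof.
window-index : ∀ {m} → Fin m → Fin (suc m) → Fin (m + m)
window-index i j = Fin.fromℕ< (+-mono-<-≤ (toℕ<n i) (s≤s⁻¹ (toℕ<n j)))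

NBCA-⊕ : ∀ {m} (f : Vec Bool (suc m) → Bool) → (∀ x y → f (x ⊕ y) ≡ f x xor f y) →
         ∀ z z′ → NBCA f (z ⊕ z′) ≡ NBCA f z ⊕ NBCA f z′
NBCA-⊕ {m} f f-⊕ z z′ =
  trans (tabulate-cong λ i → trans (cong f (window-⊕ (window-index i))) (f-⊕ _ _))
        (sym (zipWith-tabulate _xor_ _ _))
  where
  window-⊕ : ∀ {k} (σ : Fin k → Fin (m + m)) →
             tabulate (λ j → lookup (z ⊕ z′) (σ j)) ≡ tabulate (lookup z ∘ σ) ⊕ tabulate (lookup z′ ∘ σ)
  window-⊕ σ = trans (tabulate-cong λ j → lookup-zipWith _xor_ (σ j) z z′) (sym (zipWith-tabulate _xor_ _ _))

linearRule-eval : ∀ {n} (a x : Vec Bool n) w → (∀ j → lookup x j ≡ w (toℕ j)) →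
                  linearRule a x ≡ eval (toList a) w
linearRule-eval []      []      w x≡w = refl
linearRule-eval (c ∷ a) (x ∷ xs) w x≡w =
  cong₂ (λ y r → (c ∧ y) xor r) (x≡w Fin.zero) (linearRule-eval a xs (w ∘ suc) (x≡w ∘ Fin.suc))

lookup-NBCA-linearRule : ∀ {m} (a : Vec Bool (suc m)) (z : Vec Bool (m + m)) u →
                         (∀ k → lookup z k ≡ u (toℕ k)) →
                         ∀ i → lookup (NBCA (linearRule a) z) i ≡ eval (toList a) (λ j → u (toℕ i + j))
lookup-NBCA-linearRule a z u z≡u i =
  trans (lookup∘tabulate _ i) (linearRule-eval a window (λ j → u (toℕ i + j)) window≡u)
  where
  window = tabulate (lookup z ∘ window-index i)
  window≡u : ∀ j → lookup window j ≡ u (toℕ i + toℕ j)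
  window≡u j = trans (lookup∘tabulate (lookup z ∘ window-index i) j) (trans (z≡u _) (cong u (toℕ-fromℕ< _)))

NBCA-doubling-kernel : ∀ {n} → let m = suc (suc n) in (a : Vec Bool (suc m)) → last a ≡ true →
  Irreducible (assocPoly a) → ∀ v → NBCA (linearRule a) (v ++ v) ≡ replicateᵥ m false → v ≡ replicateᵥ m false
NBCA-doubling-kernel {n} a last≡true a-irr v F[v++v]≡0 =
  Pointwise-≡⇒≡ (ext λ i →
    trans (sym (cycle-toℕ v i)) (trans (cycle≡false (toℕ i)) (sym (lookup-replicate i false))))
  where
  m = suc (suc n)
  cycle-annihilated : Annihilates (toList a) (cycle v)
  cycle-annihilated = annihilates λ i → begin
    eval (toList a) (λ j → cycle v (i + j))
      ≡⟨ eval-cong (toList a) (λ j →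
           trans (cycle-+ v i j) (cong (λ t → cycle v (t + j)) (sym (toℕ-fromℕ< (m%n<n i m))))) ⟩
    eval (toList a) (λ j → cycle v (toℕ (i mod m) + j))
      ≡⟨ lookup-NBCA-linearRule a (v ++ v) (cycle v) (lookup-++-cycle v) (i mod m) ⟨
    lookup (NBCA (linearRule a) (v ++ v)) (i mod m)
      ≡⟨ cong (λ z → lookup z (i mod m)) F[v++v]≡0 ⟩
    lookup (replicateᵥ m false) (i mod m)
      ≡⟨ lookup-replicate (i mod m) false ⟩
    false ∎
  cycle≡false : ∀ k → cycle v k ≡ false
  cycle≡false =
    periodic-annihilated-by-irreducible a-irr (Degree-toList a last≡true) (cycle-periodic v) cycle-annihilated

pair-injective⇒selfOrthogonal :
  ∀ {m} (F : Vec Bool (m + m) → Vec Bool m) (φ : Vec Bool m ↔ Fin (2 ^ m)) →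
  (∀ {x y x′ y′} → F (x ++ y) ≡ F (x′ ++ y′) → F (y ++ x) ≡ F (y′ ++ x′) → x ≡ x′ × y ≡ y′) →
  SelfOrthogonal F φ
pair-injective⇒selfOrthogonal F φ pair-injective i j k l eq =
  map from-injective from-injective
      (pair-injective (to-injective (,-injectiveˡ eq)) (to-injective (,-injectiveʳ eq)))
  where
  to-injective   = Injection.injective (↔⇒↣ φ)
  from-injective = Injection.injective (↔⇒↣ (↔-sym φ))

additive-pair-injective :
  ∀ {m} (F : Vec Bool (m + m) → Vec Bool m) → (∀ z z′ → F (z ⊕ z′) ≡ F z ⊕ F z′) →
  (∀ v → F (v ++ v) ≡ replicateᵥ m false → v ≡ replicateᵥ m false) →
  ∀ {x y x′ y′} → F (x ++ y) ≡ F (x′ ++ y′) → F (y ++ x) ≡ F (y′ ++ x′) → x ≡ x′ × y ≡ y′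
additive-pair-injective {m} F F-⊕ doubling-kernel {x} {y} {x′} {y′} F[x++y]≡ F[y++x]≡ =
  ⊕≡0⇒≡ z≡0 , ⊕≡0⇒≡ (trans (sym z≡w) z≡0)
  where
  z = x ⊕ x′
  w = y ⊕ y′
  F-kernel : ∀ {s t} → F s ≡ F t → F (s ⊕ t) ≡ replicateᵥ m false
  F-kernel {s} {t} Fs≡Ft = trans (F-⊕ s t) (trans (cong (_⊕ F t) Fs≡Ft) (⊕-self (F t)))
  F[z++w]≡0 : F (z ++ w) ≡ replicateᵥ m false
  F[z++w]≡0 = trans (cong F (sym (zipWith-++ _xor_ x y x′ y′))) (F-kernel F[x++y]≡)
  F[w++z]≡0 : F (w ++ z) ≡ replicateᵥ m false
  F[w++z]≡0 = trans (cong F (sym (zipWith-++ _xor_ y x y′ x′))) (F-kernel F[y++x]≡)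
  z≡w : z ≡ w
  z≡w = ⊕≡0⇒≡ (doubling-kernel (z ⊕ w) (begin
    F ((z ⊕ w) ++ (z ⊕ w))  ≡⟨ cong (λ t → F ((z ⊕ w) ++ t)) (zipWith-comm xor-comm z w) ⟩
    F ((z ⊕ w) ++ (w ⊕ z))  ≡⟨ cong F (zipWith-++ _xor_ z w w z) ⟨
    F ((z ++ w) ⊕ (w ++ z)) ≡⟨ F-kernel (trans F[z++w]≡0 (sym F[w++z]≡0)) ⟩
    replicateᵥ m false      ∎))
  z≡0 : z ≡ replicateᵥ m false
  z≡0 = doubling-kernel z (trans (cong (λ t → F (z ++ t)) z≡w) F[z++w]≡0)

-- The hypothesis a₁ = 1 is unused: for m ≥ 2 it already follows from the irreducibility of p_f.
lemma3 : (m : ℕ) → 2 ≤ m → (a : Vec Bool (suc m)) →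
    head a ≡ true → last a ≡ true →
    Irreducible (assocPoly a) →
    (φ : Vec Bool m ↔ Fin (2 ^ m)) →
    SelfOrthogonal (NBCA (linearRule a)) φ
lemma3 (suc (suc n)) (s≤s (s≤s _)) a _ last≡true a-irr φ =
  pair-injective⇒selfOrthogonal F φ
    (additive-pair-injective F (NBCA-⊕ (linearRule a) (linearRule-⊕ a))
                               (NBCA-doubling-kernel a last≡true a-irr))
  where F = NBCA (linearRule a)
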